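{- In 1-player motion planning, any door (directed, undirected or mixed; open-required or open-optional) can simulate its corresponding open-optional door, i.e. the door with the same traverse and closing tunnels (with the same directedness) whose opening tunnel is replaced by an opening port.
   Context: A gadget consists of a finite set of locations, a finite set of states, and a set of allowed transitions $(s,p)\to(s',p')$: an agent at location $p$ while the gadget is in state $s$ may move through the gadget to location $p'$, changing its state to $s'$. A tunnel is a pair of locations; a directed tunnel can be traversed in one fixed direction only, an undirected one in both directions. In 1-player motion planning with a gadget, an instance is a system of finitely many copies of the gadget, each in a given initial state, whose locations are connected by a graph along which a single agent moves freely; given start and target locations, the question is whether the agent can reach the target. A gadget $H$ simulates a gadget $G$ if there is a finite network of copies of $H$ (in given states), some of whose locations are designated external and identified with the locations of $G$, together with a map from states of $G$ to network configurations, such that the possible movements of the agent between external locations and the resulting configurations reproduce the transitions of $G$ (in the sense of the motion-planning-through-gadgets framework of Demaine et al., where extra traversals are permitted only if they can never help the agent); in particular replacing each copy of $G$ by such a network preserves the answer to every 1-player motion planning instance. A door is a 2-state gadget (states open and closed) with three disjoint parts: an opening part, a traverse tunnel, and a closing tunnel. The traverse tunnel can be traversed only in the open state and does not change the state; the closing tunnel can always be traversed and sets the state to closed. In an open-required door the opening part is a tunnel, always traversable, whose traversal sets the state to open. In an open-optional door the opening part is a single location (opening port) at which the agent may, at its choice, set the state to open without moving. Each tunnel is individually directed or undirected; a door is directed if all its tunnels are directed, undirected if all are undirected, and mixed otherwise. -}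

module Defs where

open import Data.Nat using (ℕ)
open import Data.Fin using (Fin; _≟_)
open import Data.Product using (Σ; ∃; _×_; _,_)
open import Data.Sum using (_⊎_)
open import Relation.Nullary using (¬_; yes; no)
open import Relation.Binary.PropositionalEquality using (_≡_)
open import Relation.Binary.Construct.Closure.ReflexiveTransitive using (Star)

-- A gadget: locations, states, and transitions (s , p) → (s' , p').
-- Trans s p s' p' : an agent at location p, gadget in state s, may move
-- through the gadget to p', changing the state to s'.
record Gadget : Set₁ where
  field
    Loc   : Set
    State : Set
    Trans : State → Loc → State → Loc → Set

open Gadget public

module _ (H : Gadget) where

  -- finitely many copies of H, whose locations are connected by a graph
  -- (an undirected graph: Conn gives its edges, traversable both ways)
  record Network : Set₁ where
    field
      copies : ℕ
      Conn   : Fin copies × Loc H → Fin copies × Loc H → Set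

  open Network public

  NLoc : Network → Set
  NLoc N = Fin (copies N) × Loc H

  Config : Network → Set
  Config N = Fin (copies N) → State H

  update : (N : Network) → Config N → Fin (copies N) → State H → Config N
  update N C i s j with j ≟ i
  ... | yes _ = s
  ... | no  _ = C j

  Pos : Network → Set
  Pos N = Config N × NLoc N

  data Step (N : Network) : Pos N → Pos N → Set where
    edge   : ∀ {C l l'} → Conn N l l' → Step N (C , l) (C , l')
    edge⁻  : ∀ {C l l'} → Conn N l' l → Step N (C , l) (C , l')
    gadget : ∀ {C i x s' y} → Trans H (C i) x s' y →
             Step N (C , (i , x)) (update N C i s' , (i , y))

  Reach : (N : Network) → Pos N → Pos N → Set
  Reach N = Star (Step N)

  data InternalWalk (N : Network) (Ext : NLoc N → Set) : Pos N → Pos N → Set where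
    last : ∀ {x y} → Step N x y → InternalWalk N Ext x y
    _∷_  : ∀ {x C l z} → Step N x (C , l) → ¬ Ext l →
           InternalWalk N Ext (C , l) z → InternalWalk N Ext x z

_≗_ : {A B : Set} → (A → B) → (A → B) → Set
f ≗ g = ∀ x → f x ≡ g x

record Simulates (H G : Gadget) : Set₁ where
  field
    net     : Network H
    ext     : Loc G → NLoc H net
    ext-inj : ∀ {a b} → ext a ≡ ext b → a ≡ b
    φ       : State G → Config H net
    complete : ∀ {s a s' b} → Trans G s a s' b →
               Σ (Config H net) λ C →
                 Reach H net (φ s , ext a) (C , ext b) × (C ≗ φ s')
    sound : ∀ {s a C b} →
            InternalWalk H net (λ l → ∃ λ c → ext c ≡ l) (φ s , ext a) (C , ext b) →
            (Σ (State G) λ s' → Trans G s a s' b × (C ≗ φ s'))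
            ⊎ (a ≡ b × (C ≗ φ s))

data Dir : Set where
  directed undirected : Dir

-- the opening part: a tunnel (open-required door) or a port (open-optional)
data Opening : Set where
  tunnel : Dir → Opening
  port   : Opening

data DoorState : Set where
  closed opened : DoorState

data DoorLoc : Opening → Set where
  o₁ o₂ : ∀ {d} → DoorLoc (tunnel d)
  p     : DoorLoc port
  t₁ t₂ : ∀ {o} → DoorLoc o
  c₁ c₂ : ∀ {o} → DoorLoc o

data DoorTrans (dt dc : Dir) : (o : Opening) →
               DoorState → DoorLoc o → DoorState → DoorLoc o → Set where
  opn   : ∀ {d s} → DoorTrans dt dc (tunnel d) s o₁ opened o₂
  opn⁻  : ∀ {s} → DoorTrans dt dc (tunnel undirected) s o₂ opened o₁
  opnP  : ∀ {s} → DoorTrans dt dc port s p opened p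
  trv   : ∀ {o} → DoorTrans dt dc o opened t₁ opened t₂
  trv⁻  : ∀ {o} → dt ≡ undirected → DoorTrans dt dc o opened t₂ opened t₁
  cls   : ∀ {o s} → DoorTrans dt dc o s c₁ closed c₂
  cls⁻  : ∀ {o s} → dc ≡ undirected → DoorTrans dt dc o s c₂ closed c₁

Door : Opening → Dir → Dir → Gadget
Door o dt dc = record
  { Loc = DoorLoc o ; State = DoorState ; Trans = DoorTrans dt dc o }

{-# OPTIONS --safe #-}

-- An open-optional door simulates itself with a single copy. An open-required door
-- simulates it with a single copy whose opening tunnel is closed into a loop by an
-- edge between its ends o₁ and o₂, the port being o₁: opening at the port is a trip
-- through the tunnel and back along the edge. The only internal location is o₂, and
-- every excursion through it leaves from o₁ and returns to o₁ with the door either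
-- unchanged or opened, which is exactly what the port allows.

module Submission where

open import Defs
open import Data.Empty using (⊥; ⊥-elim)
open import Data.Fin using (Fin; zero)
open import Data.Product using (Σ; ∃; _×_; _,_; proj₂)
open import Data.Sum using (_⊎_; inj₁; inj₂)
open import Function using (const)
open import Relation.Nullary using (¬_)
open import Relation.Binary.PropositionalEquality using (_≡_; _≢_; refl; cong; subst₂)
open import Relation.Binary.Construct.Closure.ReflexiveTransitive using (ε; _◅_)

module SingleCopy (H : Gadget) (E : Loc H → Loc H → Set) where

  network : Network H
  network = record { copies = 1 ; Conn = λ (_ , x) (_ , y) → E x y }

  private variable
    s s' : State H
    x y : Loc H
    C C' : Config H network

  data Move : State H × Loc H → State H × Loc H → Set where
    edge   : E x y → Move (s , x) (s , y)
    edge⁻  : E y x → Move (s , x) (s , y)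
    gadget : Trans H s x s' y → Move (s , x) (s' , y)

  config-const : (C : Config H network) → C ≗ const (C zero)
  config-const C zero = refl

  step⇒move : ∀ {i j} → Step H network (C , (i , x)) (C' , (j , y)) →
              Move (C zero , x) (C' zero , y)
  step⇒move (edge e)              = edge e
  step⇒move (edge⁻ e)             = edge⁻ e
  step⇒move (gadget {i = zero} t) = gadget t

  trans⇒reach : Trans H s x s' y →
                Σ (Config H network) λ C →
                  Reach H network (const s , (zero , x)) (C , (zero , y)) × (C ≗ const s')
  trans⇒reach t = _ , gadget t ◅ ε , config-const _

simulates-refl : (G : Gadget) → Simulates G G
simulates-refl G = record
  { net = network ; ext = zero ,_ ; ext-inj = λ { refl → refl } ; φ = const
  ; complete = trans⇒reach ; sound = sound }
  where
  open SingleCopy G (λ _ _ → ⊥)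

  sound : ∀ {s a C b} →
          InternalWalk G network (λ l → ∃ λ c → (zero , c) ≡ l) (const s , (zero , a)) (C , (zero , b)) →
          (Σ (State G) λ s' → Trans G s a s' b × (C ≗ const s')) ⊎ (a ≡ b × (C ≗ const s))
  sound (last st) with step⇒move st
  ... | edge ()
  ... | edge⁻ ()
  ... | gadget t = inj₁ (_ , t , config-const _)
  sound (_∷_ {l = zero , x} _ internal _) = ⊥-elim (internal (x , refl))

data KeepOrOpen : DoorState → DoorState → Set where
  keep  : ∀ {s} → KeepOrOpen s s
  opens : ∀ {s} → KeepOrOpen s opened

keepOrOpen-trans : ∀ {s₁ s₂ s₃} → KeepOrOpen s₁ s₂ → KeepOrOpen s₂ s₃ → KeepOrOpen s₁ s₃
keepOrOpen-trans r keep  = r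
keepOrOpen-trans _ opens = opens

module OpeningTunnel (d dt dc : Dir) where

  data Loop : DoorLoc (tunnel d) → DoorLoc (tunnel d) → Set where
    o₁o₂ : Loop o₁ o₂

  open SingleCopy (Door (tunnel d) dt dc) Loop

  private variable
    s s' : DoorState
    x y : DoorLoc (tunnel d)

  embed : DoorLoc port → DoorLoc (tunnel d)
  embed p  = o₁
  embed t₁ = t₁
  embed t₂ = t₂
  embed c₁ = c₁
  embed c₂ = c₂

  retract : DoorLoc (tunnel d) → DoorLoc port
  retract o₁ = p
  retract o₂ = p
  retract t₁ = t₁
  retract t₂ = t₂
  retract c₁ = c₁
  retract c₂ = c₂

  retract-embed : ∀ a → retract (embed a) ≡ a
  retract-embed p  = refl
  retract-embed t₁ = refl
  retract-embed t₂ = refl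
  retract-embed c₁ = refl
  retract-embed c₂ = refl

  embed-injective : ∀ {a b} → embed a ≡ embed b → a ≡ b
  embed-injective {a} {b} eq = subst₂ _≡_ (retract-embed a) (retract-embed b) (cong retract eq)

  embed≢o₂ : ∀ a → embed a ≢ o₂
  embed≢o₂ p  ()
  embed≢o₂ t₁ ()
  embed≢o₂ t₂ ()
  embed≢o₂ c₁ ()
  embed≢o₂ c₂ ()

  leave-o₂ : Move (s , o₂) (s' , y) → y ≡ o₁ × KeepOrOpen s s'
  leave-o₂ (edge ())
  leave-o₂ (edge⁻ o₁o₂)  = refl , keep
  leave-o₂ (gadget opn⁻) = refl , opens

  enter-o₂ : Move (s , x) (s' , o₂) → x ≡ o₁ × KeepOrOpen s s'
  enter-o₂ (edge o₁o₂)  = refl , keep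
  enter-o₂ (edge⁻ ())
  enter-o₂ (gadget opn) = refl , opens

  move⇒port-trans : Move (s , x) (s' , y) → x ≢ o₂ → y ≢ o₂ →
                    DoorTrans dt dc port s (retract x) s' (retract y)
  move⇒port-trans (edge o₁o₂)       _    y≢o₂ = ⊥-elim (y≢o₂ refl)
  move⇒port-trans (edge⁻ o₁o₂)      x≢o₂ _    = ⊥-elim (x≢o₂ refl)
  move⇒port-trans (gadget opn)      _    y≢o₂ = ⊥-elim (y≢o₂ refl)
  move⇒port-trans (gadget opn⁻)     x≢o₂ _    = ⊥-elim (x≢o₂ refl)
  move⇒port-trans (gadget trv)      _    _    = trv
  move⇒port-trans (gadget (trv⁻ q)) _    _    = trv⁻ q
  move⇒port-trans (gadget cls)      _    _    = cls
  move⇒port-trans (gadget (cls⁻ q)) _    _    = cls⁻ q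

  External : Fin 1 × DoorLoc (tunnel d) → Set
  External l = ∃ λ a → (zero , embed a) ≡ l

  internal⇒o₂ : ∀ {i x} → ¬ External (i , x) → x ≡ o₂
  internal⇒o₂ {zero} {o₁} internal = ⊥-elim (internal (p , refl))
  internal⇒o₂ {zero} {o₂} _        = refl
  internal⇒o₂ {zero} {t₁} internal = ⊥-elim (internal (t₁ , refl))
  internal⇒o₂ {zero} {t₂} internal = ⊥-elim (internal (t₂ , refl))
  internal⇒o₂ {zero} {c₁} internal = ⊥-elim (internal (c₁ , refl))
  internal⇒o₂ {zero} {c₂} internal = ⊥-elim (internal (c₂ , refl))

  embedded-move⇒port-trans : ∀ {a b} → Move (s , embed a) (s' , embed b) →
                             DoorTrans dt dc port s a s' b
  embedded-move⇒port-trans {a = a} {b} m =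
    subst₂ (λ a b → DoorTrans dt dc port _ a _ b) (retract-embed a) (retract-embed b)
           (move⇒port-trans m (embed≢o₂ a) (embed≢o₂ b))

  walk-from-o₂ : ∀ {C₁ C} → InternalWalk _ network External (C₁ , (zero , o₂)) (C , (zero , y)) →
                 y ≡ o₁ × KeepOrOpen (C₁ zero) (C zero)
  walk-from-o₂ (last st) = leave-o₂ (step⇒move st)
  walk-from-o₂ (_∷_ {l = zero , _} st internal _)
    with internal⇒o₂ internal | leave-o₂ (step⇒move st)
  ... | refl | () , _

  Outcome : DoorState → DoorLoc port → Config _ network → DoorLoc port → Set
  Outcome s a C b = (Σ DoorState λ s' → DoorTrans dt dc port s a s' b × (C ≗ const s'))
                  ⊎ (a ≡ b × (C ≗ const s))

  round-trip : ∀ {a b C} → a ≡ p → b ≡ p → KeepOrOpen s s' → C ≗ const s' → Outcome s a C b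
  round-trip refl refl keep  C≗s' = inj₂ (refl , C≗s')
  round-trip refl refl opens C≗s' = inj₁ (opened , opnP , C≗s')

  sound : ∀ {s a C b} →
          InternalWalk _ network External (const s , (zero , embed a)) (C , (zero , embed b)) →
          Outcome s a C b
  sound (last st) = inj₁ (_ , embedded-move⇒port-trans (step⇒move st) , config-const _)
  sound (_∷_ {l = zero , _} st internal w) with internal⇒o₂ internal
  ... | refl with enter-o₂ (step⇒move st) | walk-from-o₂ w
  ...   | a↦o₁ , r₁ | b↦o₁ , r₂ =
    round-trip (embed-injective a↦o₁) (embed-injective b↦o₁) (keepOrOpen-trans r₁ r₂) (config-const _)

  complete : ∀ {s a s' b} → DoorTrans dt dc port s a s' b →
             Σ (Config _ network) λ C →
               Reach _ network (const s , (zero , embed a)) (C , (zero , embed b)) × (C ≗ const s')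
  complete opnP     = _ , gadget opn ◅ edge⁻ o₁o₂ ◅ ε , config-const _
  complete trv      = trans⇒reach trv
  complete (trv⁻ q) = trans⇒reach (trv⁻ q)
  complete cls      = trans⇒reach cls
  complete (cls⁻ q) = trans⇒reach (cls⁻ q)

  simulates-open-optional : Simulates (Door (tunnel d) dt dc) (Door port dt dc)
  simulates-open-optional = record
    { net = network ; ext = λ a → zero , embed a
    ; ext-inj = λ eq → embed-injective (cong proj₂ eq) ; φ = const
    ; complete = complete ; sound = sound }

mainTheorem1 : (o : Opening) (dt dc : Dir) → Simulates (Door o dt dc) (Door port dt dc)
mainTheorem1 port       dt dc = simulates-refl (Door port dt dc)
mainTheorem1 (tunnel d) dt dc = OpeningTunnel.simulates-open-optional d dt dc
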